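{- Let $L=(L_1,\dots,L_m)$ be an ordered finite family of nonempty finite sets (lists) and let $H=T(L)$ be its transversal hypergraph. Let $v_1$ be a vertex of $H$ and let $L'$ be the subfamily of lists of $L$ that contain $v_1$. Then every minimal edge (minimal transversal) $e$ of $H$ with $v_1\in e$ represents at least one track in which $v_1$ is chosen from every list in $L'$.
   Context: A transversal of a family of sets is a set meeting each member of the family. The transversal hypergraph $T(L)$ has as vertices the union of the lists of $L$ and as edges all transversals of $L$ of cardinality at most $m$ (the number of lists). A minimal edge of $T(L)$ is an edge not containing any other edge. A track of $L$ is an $m$-tuple $(c_1,\dots,c_m)$ with $c_i\in L_i$ for each $i$. A transversal $e$ represents a track $t$ (and $t$ belongs to $e$) if the set of distinct entries of $t$ is exactly $e$. -}

module Defs where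

open import Data.Nat using (ℕ; _≤_)
open import Data.Fin using (Fin)
open import Data.Fin.Subset using (Subset; _∈_; _⊆_; _∩_; ⋃; Nonempty; ∣_∣)
open import Data.Vec using (Vec; lookup; toList)
open import Data.Product using (Σ; ∃; _×_)
open import Relation.Binary.PropositionalEquality using (_≡_)
open import Function.Bundles using (_⇔_)

Family : ℕ → ℕ → Set
Family n m = Vec (Subset n) m

vertices : ∀ {n m} → Family n m → Subset n
vertices L = ⋃ (toList L)

IsTransversal : ∀ {n m} → Family n m → Subset n → Set
IsTransversal {m = m} L e = (i : Fin m) → Nonempty (e ∩ lookup L i)

IsEdge : ∀ {n m} → Family n m → Subset n → Set
IsEdge {m = m} L e = (e ⊆ vertices L) × IsTransversal L e × (∣ e ∣ ≤ m)

IsMinimalEdge : ∀ {n m} → Family n m → Subset n → Set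
IsMinimalEdge L e = IsEdge L e × (∀ f → IsEdge L f → f ⊆ e → f ≡ e)

IsTrack : ∀ {n m} → Family n m → Vec (Fin n) m → Set
IsTrack {m = m} L t = (i : Fin m) → lookup t i ∈ lookup L i

Represents : ∀ {n m} → Subset n → Vec (Fin n) m → Set
Represents {n} {m} e t = (x : Fin n) → (x ∈ e ⇔ ∃ λ (i : Fin m) → lookup t i ≡ x)

{-# OPTIONS --safe #-}
module Submission where

-- In a minimal transversal e every vertex x has a private list L_i, meeting e
-- only in x: otherwise e - x would still be a transversal, hence a smaller edge.
-- So a track all of whose entries lie in e takes the value x at the private list
-- of x, for every x ∈ e, i.e. it represents e. Such a track exists: choose v₁
-- from the lists containing it and any vertex of e from the others.

open import Defs
open import Data.Nat.Properties using (≤-trans)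
open import Data.Fin using (Fin; _≟_)
open import Data.Fin.Subset using (Subset; _∈_; _∩_; _-_; _⊆_; _⊂_; Nonempty)
open import Data.Fin.Subset.Properties
  using (_∈?_; nonempty?; ⊆-trans; ⊂-irref; p⊆q⇒∣p∣≤∣q∣; x∈p⇒p-x⊂p; x∈p∩q⁺; x∈p∩q⁻; x∈p∧x≢y⇒x∈p-y)
open import Data.Fin.Properties using (¬∀⟶∃¬)
open import Data.Vec using (Vec; lookup; tabulate)
open import Data.Vec.Properties using (lookup∘tabulate)
open import Data.Product using (Σ; ∃; _×_; _,_; proj₁; proj₂)
open import Relation.Binary.PropositionalEquality using (_≡_; refl; subst)
open import Relation.Nullary using (yes; no; ¬_; contradiction)
open import Function.Base using (_∘_)
open import Function.Bundles using (mk⇔)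

module _ {n m} (L : Family n m) where

  transversal⊆edge⇒edge : ∀ {e f} → IsEdge L e → f ⊆ e → IsTransversal L f → IsEdge L f
  transversal⊆edge⇒edge (e⊆V , _ , ∣e∣≤m) f⊆e f-tr =
    ⊆-trans f⊆e e⊆V , f-tr , ≤-trans (p⊆q⇒∣p∣≤∣q∣ f⊆e) ∣e∣≤m

  minimalEdge⇒removal-not-transversal : ∀ {e x} → IsMinimalEdge L e → x ∈ e →
                                        ¬ IsTransversal L (e - x)
  minimalEdge⇒removal-not-transversal {e} {x} (edge , minimal) x∈e e-x-tr =
    ⊂-irref (minimal _ (transversal⊆edge⇒edge edge e-x⊆e e-x-tr) e-x⊆e) e-x⊂e
    where
    e-x⊂e : e - x ⊂ e
    e-x⊂e = x∈p⇒p-x⊂p x∈e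
    e-x⊆e : e - x ⊆ e
    e-x⊆e = proj₁ e-x⊂e

  private-list : ∀ {e x} → ¬ IsTransversal L (e - x) →
                 ∃ λ i → ∀ {y} → y ∈ e → y ∈ lookup L i → y ≡ x
  private-list {e} {x} e-x-not-tr = i , only-x
    where
    missed : ∃ λ i → ¬ Nonempty ((e - x) ∩ lookup L i)
    missed = ¬∀⟶∃¬ m _ (λ i → nonempty? ((e - x) ∩ lookup L i)) e-x-not-tr
    i : Fin m
    i = proj₁ missed
    only-x : ∀ {y} → y ∈ e → y ∈ lookup L i → y ≡ x
    only-x {y} y∈e y∈Lᵢ with y ≟ x
    ... | yes y≡x = y≡x
    ... | no  y≢x = contradiction (y , x∈p∩q⁺ (x∈p∧x≢y⇒x∈p-y y∈e y≢x , y∈Lᵢ)) (proj₂ missed)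

  minimalEdge-represents-tracks-within : ∀ {e t} → IsMinimalEdge L e → IsTrack L t →
                                         (∀ i → lookup t i ∈ e) → Represents e t
  minimalEdge-represents-tracks-within {e} {t} minimal t-track t⊆e x =
    mk⇔ occurs (λ (i , tᵢ≡x) → subst (_∈ e) tᵢ≡x (t⊆e i))
    where
    occurs : x ∈ e → ∃ λ i → lookup t i ≡ x
    occurs x∈e with private-list (minimalEdge⇒removal-not-transversal minimal x∈e)
    ... | i , only-x = i , only-x (t⊆e i) (t-track i)

  track-within-through : ∀ {e} v → IsTransversal L e → v ∈ e →
                         Σ (Vec (Fin n) m) λ t → IsTrack L t × (∀ i → lookup t i ∈ e) ×
                           (∀ i → v ∈ lookup L i → lookup t i ≡ v)
  track-within-through {e} v e-tr v∈e = t , t-track , t⊆e , t-through-v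
    where
    choice : ∀ i → Σ (Fin n) λ c → c ∈ lookup L i × c ∈ e × (v ∈ lookup L i → c ≡ v)
    choice i with v ∈? lookup L i
    ... | yes v∈Lᵢ = v , v∈Lᵢ , v∈e , λ _ → refl
    ... | no  v∉Lᵢ with e-tr i
    ...   | c , c∈e∩Lᵢ with x∈p∩q⁻ e (lookup L i) c∈e∩Lᵢ
    ...     | c∈e , c∈Lᵢ = c , c∈Lᵢ , c∈e , λ v∈Lᵢ → contradiction v∈Lᵢ v∉Lᵢ

    t : Vec (Fin n) m
    t = tabulate (proj₁ ∘ choice)

    t-entry : ∀ i → lookup t i ≡ proj₁ (choice i)
    t-entry = lookup∘tabulate (proj₁ ∘ choice)

    t-track : IsTrack L t
    t-track i rewrite t-entry i = proj₁ (proj₂ (choice i))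

    t⊆e : ∀ i → lookup t i ∈ e
    t⊆e i rewrite t-entry i = proj₁ (proj₂ (proj₂ (choice i)))

    t-through-v : ∀ i → v ∈ lookup L i → lookup t i ≡ v
    t-through-v i rewrite t-entry i = proj₂ (proj₂ (proj₂ (choice i)))

lemma6 : ∀ {n m} (L : Family n m) → ((i : Fin m) → Nonempty (lookup L i)) →
         (v₁ : Fin n) → v₁ ∈ vertices L →
         (e : Subset n) → IsMinimalEdge L e → v₁ ∈ e →
         Σ (Vec (Fin n) m) λ t → IsTrack L t × Represents e t ×
           ((i : Fin m) → v₁ ∈ lookup L i → lookup t i ≡ v₁)
lemma6 L _ v₁ _ e minimal v₁∈e
  with track-within-through L v₁ (proj₁ (proj₂ (proj₁ minimal))) v₁∈e
... | t , t-track , t⊆e , t-through-v₁ =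
  t , t-track , minimalEdge-represents-tracks-within L {t = t} minimal t-track t⊆e , t-through-v₁
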